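{- Let $\alpha$ be a type-$B$ composition of $n$. For any $\pi,\sigma,\pi'\in\mathfrak{H}_\alpha$ with $\pi\leq_{\mathsf{weak}}\sigma\leq_{\mathsf{weak}}\pi'$, if $\Pi^\alpha_\downarrow(\pi)=\Pi^\alpha_\downarrow(\pi')$, then $\Pi^\alpha_\downarrow(\sigma)=\Pi^\alpha_\downarrow(\pi)$.
   Context: $\mathfrak{H}_n$ is the group of permutations $\pi$ of $\pm[n]=\{ -n,\dots,-1,1,\dots,n\}$ with $\pi(-a)=-\pi(a)$, the Coxeter group of type $B_n$ with simple generators $s_0$ (exchanging $1,-1$) and $s_i$ (exchanging $i,i+1$ and $-i,-i-1$); $\ell_S$ is Coxeter length. $\mathsf{Inv}(\pi)$ consists of $[\![i]\!]$ (exchanging $i,-i$) with $\pi(i)<0$, $(\!(i\;j)\!)$ ($0<i<j$) with $\pi(i)>\pi(j)$ and $(\!(-j\;i)\!)$ ($0<i<j$) with $\pi(-j)>\pi(i)$ (these are the reflections $t$ with $\ell_S(\pi t)<\ell_S(\pi)$). Weak order: $u\le_{\mathsf{weak}}v$ iff $\mathsf{Inv}(u)\subseteq\mathsf{Inv}(v)$. A type-$B$ composition of $n$: positive integers $(\alpha_1,\dots,\alpha_r)$ summing to $n$, possibly preceded by a component $0$ (split if present, join otherwise); $p_0=0$, $p_i=\alpha_1+\dots+\alpha_i$. $\mathsf{Part}(\alpha)$: blocks $\{p_{i-1}+1,\dots,p_i\}$ and $\{ -p_i,\dots,-p_{i-1}-1\}$, $1\le i\le r$, with the two $i=1$ blocks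 merged if $\alpha$ is join. $\mathfrak{H}_\alpha$: the minimal-length coset representatives $\{w:\ell_S(ws)>\ell_S(w)\ \forall s\in S\setminus J_\alpha\}$, $J_\alpha=\{s_{p_1},\dots,s_{p_{r-1}}\}\cup(\{s_0\}$ if split$)$; equivalently the $\pi$ increasing on each block. $x^+=x+1$ for $x\ne-1$, $(-1)^+=1$. A $(\alpha,231)$-pattern of $\pi\in\mathfrak{H}_\alpha$ is a triple $i<j<k$ in $\pm[n]$ in pairwise different blocks, $j>0$, $\pi(i)=\pi(k)^+$, and: if $\alpha$ is split, $\pi(i)<\pi(j)$; if $\alpha$ is join, either ($j>\alpha_1$ and $\pi(j)>\pi(i)$) or ($0<j\le\alpha_1$ and $\pi(j)<\pi(k)$). $\mathfrak{H}_\alpha(231)$ is the set of pattern-avoiding elements of $\mathfrak{H}_\alpha$. For $\pi\in\mathfrak{H}_\alpha$, $\Pi^\alpha_\downarrow(\pi)$ denotes the unique element of $\mathfrak{H}_\alpha(231)$ whose inversion set is contained in $\mathsf{Inv}(\pi)$ and is maximal by inclusion among all such elements. -}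

module Defs where

open import Data.Bool using (Bool; true; false)
open import Data.Nat as ℕ using (ℕ; zero; suc; _∸_; _≤?_)
open import Data.Integer as ℤ using (ℤ; +_; -[1+_]; -_; ∣_∣; 0ℤ; 1ℤ)
open import Data.List using (List; []; _∷_)
open import Data.Nat.ListAction using (sum)
open import Data.List.Relation.Unary.All using (All)
open import Data.Product using (_×_; Σ)
open import Data.Sum using (_⊎_)
open import Data.Empty using (⊥)
open import Relation.Nullary using (yes; no)
open import Relation.Binary.PropositionalEquality using (_≡_; _≢_)

-- Signed permutations of ±[n] = {-n,…,-1,1,…,n} ⊆ ℤ.
-- A signed permutation is represented by a function ℤ → ℤ; only its
-- values on ±[n] matter.

InPM : ℕ → ℤ → Set
InPM n x = (0 ℕ.< ∣ x ∣) × (∣ x ∣ ℕ.≤ n)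

record IsSignedPerm (n : ℕ) (π : ℤ → ℤ) : Set where
  field
    closed : ∀ a → InPM n a → InPM n (π a)
    inj    : ∀ a b → InPM n a → InPM n b → π a ≡ π b → a ≡ b
    odd    : ∀ a → InPM n a → π (- a) ≡ - π a

-- Reflections and inversion sets.
--   bar i  = [[i]]        (1 ≤ i ≤ n)
--   tr i j = ((i j))      (0 < i < j ≤ n)
--   ng j i = ((-j i))     (0 < i < j ≤ n)

data Refl : Set where
  bar : ℕ → Refl
  tr  : ℕ → ℕ → Refl
  ng  : ℕ → ℕ → Refl

data Inv (n : ℕ) (π : ℤ → ℤ) : Refl → Set where
  inv-bar : ∀ {i} → 1 ℕ.≤ i → i ℕ.≤ n → π (+ i) ℤ.< 0ℤ → Inv n π (bar i)
  inv-tr  : ∀ {i j} → 1 ℕ.≤ i → i ℕ.< j → j ℕ.≤ n →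
            π (+ j) ℤ.< π (+ i) → Inv n π (tr i j)
  inv-ng  : ∀ {i j} → 1 ℕ.≤ i → i ℕ.< j → j ℕ.≤ n →
            π (+ i) ℤ.< π (- (+ j)) → Inv n π (ng j i)

_⊆Inv_ : {n : ℕ} → (ℤ → ℤ) → (ℤ → ℤ) → Set
_⊆Inv_ {n} u v = ∀ t → Inv n u t → Inv n v t

WeakLe : ℕ → (ℤ → ℤ) → (ℤ → ℤ) → Set
WeakLe n u v = _⊆Inv_ {n} u v

-- Type-B compositions of n.
-- split = true  : the composition is (0, α₁, …, αᵣ)
-- split = false : the composition is (α₁, …, αᵣ)   (join)

record BComp (n : ℕ) : Set where
  field
    split : Bool
    parts : List ℕ
    pos   : All (λ a → 1 ℕ.≤ a) parts
    total : sum parts ≡ n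
open BComp public

-- index i (1-based) with p_{i-1} < a ≤ p_i, for 1 ≤ a ≤ n
blockIdx : List ℕ → ℕ → ℕ
blockIdx [] a = 0
blockIdx (c ∷ cs) a with a ≤? c
... | yes _ = 1
... | no  _ = suc (blockIdx cs (a ∸ c))

firstPart : List ℕ → ℕ
firstPart []      = 0
firstPart (c ∷ _) = c

-- block label of x ∈ ±[n] in Part(α):  +i for the positive block i,
-- -i for the negative block i, and 0 for the merged block (join, i = 1).
blk : {n : ℕ} → BComp n → ℤ → ℤ
blk α (+ a) with split α | blockIdx (parts α) a
... | false | 1 = 0ℤ
... | _     | i = + i
blk α -[1+ a ] with split α | blockIdx (parts α) (suc a)
... | false | 1 = 0ℤ
... | _     | i = - (+ i)

InH : {n : ℕ} → BComp n → (ℤ → ℤ) → Set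
InH {n} α π = IsSignedPerm n π ×
  (∀ x y → InPM n x → InPM n y → blk α x ≡ blk α y → x ℤ.< y → π x ℤ.< π y)

_⁺ : ℤ → ℤ
(+ m) ⁺          = + suc m
-[1+ zero ] ⁺    = 1ℤ
-[1+ suc k ] ⁺   = -[1+ k ]

PatCond : {n : ℕ} → BComp n → (ℤ → ℤ) → ℤ → ℤ → ℤ → Set
PatCond α π i j k with split α
... | true  = π i ℤ.< π j
... | false = ((+ firstPart (parts α)) ℤ.< j × π i ℤ.< π j)
            ⊎ (j ℤ.≤ + firstPart (parts α) × π j ℤ.< π k)

record Pattern {n : ℕ} (α : BComp n) (π : ℤ → ℤ) (i j k : ℤ) : Set where
  field
    inI : InPM n i
    inJ : InPM n j
    inK : InPM n k
    i<j : i ℤ.< j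
    j<k : j ℤ.< k
    bij : blk α i ≢ blk α j
    bik : blk α i ≢ blk α k
    bjk : blk α j ≢ blk α k
    jpos : 0ℤ ℤ.< j
    val : π i ≡ (π k) ⁺
    cond : PatCond α π i j k

Avoids : {n : ℕ} → BComp n → (ℤ → ℤ) → Set
Avoids α π = ∀ i j k → Pattern α π i j k → ⊥

InH231 : {n : ℕ} → BComp n → (ℤ → ℤ) → Set
InH231 α π = InH α π × Avoids α π

-- IsProjDown α π ρ  :⇔  ρ = Π^α_↓(π), i.e. ρ ∈ 𝔥_α(231),
-- Inv(ρ) ⊆ Inv(π), and Inv(ρ) is maximal by inclusion among such.

IsProjDown : {n : ℕ} → BComp n → (ℤ → ℤ) → (ℤ → ℤ) → Set
IsProjDown {n} α π ρ =
  InH231 α ρ × WeakLe n ρ π ×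
  (∀ τ → InH231 α τ → WeakLe n τ π → WeakLe n ρ τ → WeakLe n τ ρ)

{-# OPTIONS --safe #-}
module Submission where

open import Defs
open import Data.Nat using (ℕ)
open import Data.Integer using (ℤ)
open import Data.Product using (_,_)

WeakLe-trans : ∀ {n} {u v w : ℤ → ℤ} → WeakLe n u v → WeakLe n v w → WeakLe n u w
WeakLe-trans u≤v v≤w t t∈u = v≤w t (u≤v t t∈u)

IsProjDown-between : ∀ {n} (α : BComp n) {π σ π′ ρ : ℤ → ℤ} →
  WeakLe n π σ → WeakLe n σ π′ →
  IsProjDown α π ρ → IsProjDown α π′ ρ → IsProjDown α σ ρ
IsProjDown-between α π≤σ σ≤π′ (ρ-avoids , ρ≤π , _) (_ , _ , ρ-maximal-below-π′) =
  ρ-avoids , WeakLe-trans ρ≤π π≤σ ,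
  λ τ τ-avoids τ≤σ ρ≤τ → ρ-maximal-below-π′ τ τ-avoids (WeakLe-trans τ≤σ σ≤π′) ρ≤τ

proposition58 : {n : ℕ} (α : BComp n) (π σ π′ ρ : ℤ → ℤ) →
    InH α π → InH α σ → InH α π′ →
    WeakLe n π σ → WeakLe n σ π′ →
    IsProjDown α π ρ → IsProjDown α π′ ρ →
    IsProjDown α σ ρ
proposition58 α π σ π′ ρ _ _ _ = IsProjDown-between α
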